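{- Let $r<n$ be positive integers. Every deterministic streaming algorithm for $\mathrm{MIF}(n,r)$ requires $\Omega\left(\sqrt{r} + \frac{r}{1 + \log(n/r)}\right)$ bits of space.
   Context: For integers $r<n$, $\mathrm{MIF}(n,r)$ (Missing Item Finding): given a stream $a_1,\ldots,a_r\in[n]$ (repetitions allowed), output some $x\in[n]$ with $x\ne a_i$ for all $i$. A deterministic streaming algorithm has a finite state set $\Sigma$, a fixed initial state, a deterministic transition function $\Sigma\times[n]\to\Sigma$ and a deterministic output function $\Sigma\to[n]$, and must output a correct answer at the end of every stream in $[n]^r$; its space is $\lceil\log_2|\Sigma|\rceil$ bits. Logarithms base 2. -}

module Defs where

open import Data.Nat using (ℕ; zero; suc)
open import Data.Fin using (Fin)
open import Data.Vec using (Vec; []; _∷_)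
open import Data.Vec.Membership.Propositional using (_∈_)
open import Data.Nat.Logarithm using (⌈log₂_⌉)
open import Relation.Nullary using (¬_)

record StreamAlg (n : ℕ) : Set where
  field
    states : ℕ
    init   : Fin states
    δ      : Fin states → Fin n → Fin states
    out    : Fin states → Fin n

open StreamAlg public

run : ∀ {n m} (A : StreamAlg n) → Fin (states A) → Vec (Fin n) m → Fin (states A)
run A q []       = q
run A q (a ∷ as) = run A (δ A q a) as

SolvesMIF : (n r : ℕ) → StreamAlg n → Set
SolvesMIF n r A = (s : Vec (Fin n) r) → ¬ (out A (run A (init A) s) ∈ s)

space : ∀ {n} → StreamAlg n → ℕ
space A = ⌈log₂ states A ⌉

{-# OPTIONS --safe #-}
module Submission where

-- Cut the stream into rounds of t = space + 1 letters and keep an alphabet P ⊆ [n] such that,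
-- from the current state, every stream over P is answered by a letter of P. For a state s let
-- seen s be the letters occurring in some t-letter stream over P that leads to s. If
-- |seen s| ≥ |P|/2 for some reachable s, then after such a stream every answer avoids seen s
-- (otherwise a stream reaching s and containing the answer would be answered wrongly), so the
-- rest of the stream is solved over P ─ seen s, at most half of P. Otherwise a t-letter stream is
-- determined by its final state and the positions of its letters in that state's seen set, so
-- |P|^t ≤ S (|P|/2)^t, i.e. 2^t ≤ S ≤ 2^space, which is impossible. Hence every round halves P,
-- until the remaining stream is long enough to list all of P and cannot be answered. Starting
-- from the at most S ≤ 2^space possible outputs this gives r ≤ space (space + 1); starting from
-- all n < 2^(1 + log(n/r)) r letters it gives r < 2 (2 + log(n/r)) (space + 1).

open import Defs
open import Data.Nat
  using (ℕ; zero; suc; _+_; _*_; _∸_; _^_; _/_; _≤_; _<_; _≤?_; z≤n; s≤s⁻¹; z<s; s<s;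
         NonZero; >-nonZero; >-nonZero⁻¹; ⌊_/2⌋; ⌈_/2⌉)
open import Data.Nat.Properties
open import Data.Nat.DivMod using (_%_; m%n<n; m<n⇒m%n≡m; m≡m%n+[m/n]*n; m<n*o⇒m/o<n)
open import Data.Nat.Logarithm using (⌊log₂_⌋; ⌈log₂_⌉; ⌊log₂⌋-mono-≤; ⌊log₂[2^n]⌋≡n)
open import Data.Nat.Logarithm.Core using (⌈log2⌉)
open import Data.Nat.Induction using (<-wellFounded)
open import Data.Nat.Tactic.RingSolver using (solve-∀)
open import Induction.WellFounded using (Acc; acc)
open import Data.Fin using (Fin; zero; suc; toℕ; fromℕ<; inject≤; combine; remQuot)
import Data.Fin.Properties as Fin
open import Data.Fin.Subset using (Subset; inside; outside; ∣_∣; _─_; _⊆_; Nonempty)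
  renaming (_∈_ to _∈ₛ_; _∉_ to _∉ₛ_)
open import Data.Fin.Subset.Properties using (drop-∷-⊆; p─q⊆p; x∈p∧x∉q⇒x∈p─q; ∣p∣≤n)
  renaming (_∈?_ to _∈ₛ?_)
open import Data.Product using (∃; ∃₂; _×_; _,_; proj₁; proj₂)
open import Data.Sum using (_⊎_; inj₁; inj₂)
open import Data.Vec using (Vec; []; _∷_; _++_; map; tabulate; here; there)
open import Data.Vec.Properties using (∷-injective; lookup∘tabulate; lookup⇒[]=; []=⇒lookup)
open import Data.Vec.Relation.Unary.All as All using (All; []; _∷_)
open import Data.Vec.Relation.Unary.All.Properties using (++⁺; map⁺; tabulate⁺; lookup⁻)
open import Data.Vec.Membership.Propositional using (_∈_; _∉_)
open import Data.Vec.Membership.Propositional.Properties using (∈-++⁺ˡ; ∈-++⁺ʳ; ∈-lookup; ∈-tabulate⁺)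
open import Function using (_∘_)
open import Relation.Binary.PropositionalEquality
open import Relation.Nullary using (Dec; yes; no; does; contradiction; map′; _×-dec_)
open import Relation.Nullary.Decidable using (dec-true)

private
  variable
    m n t : ℕ

enumerate : (p : Subset n) → Fin ∣ p ∣ → Fin n
enumerate (inside  ∷ p) zero    = zero
enumerate (inside  ∷ p) (suc i) = suc (enumerate p i)
enumerate (outside ∷ p) i       = suc (enumerate p i)

enumerate-∈ : (p : Subset n) (i : Fin ∣ p ∣) → enumerate p i ∈ₛ p
enumerate-∈ (inside  ∷ p) zero    = here
enumerate-∈ (inside  ∷ p) (suc i) = there (enumerate-∈ p i)
enumerate-∈ (outside ∷ p) i       = there (enumerate-∈ p i)

enumerate-injective : (p : Subset n) {i j : Fin ∣ p ∣} → enumerate p i ≡ enumerate p j → i ≡ j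
enumerate-injective (inside  ∷ p) {zero}  {zero}  _ = refl
enumerate-injective (inside  ∷ p) {suc i} {suc j} e = cong suc (enumerate-injective p (Fin.suc-injective e))
enumerate-injective (outside ∷ p)                 e = enumerate-injective p (Fin.suc-injective e)

index : {p : Subset n} {x : Fin n} → x ∈ₛ p → Fin ∣ p ∣
index {p = inside  ∷ p} here        = zero
index {p = inside  ∷ p} (there x∈p) = suc (index x∈p)
index {p = outside ∷ p} (there x∈p) = index x∈p

enumerate-index : {p : Subset n} {x : Fin n} (x∈p : x ∈ₛ p) → enumerate p (index x∈p) ≡ x
enumerate-index {p = inside  ∷ p} here        = refl
enumerate-index {p = inside  ∷ p} (there x∈p) = cong suc (enumerate-index x∈p)
enumerate-index {p = outside ∷ p} (there x∈p) = cong suc (enumerate-index x∈p)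

index-injective : {p : Subset n} {x y : Fin n} (x∈p : x ∈ₛ p) (y∈p : y ∈ₛ p) →
                  index x∈p ≡ index y∈p → x ≡ y
index-injective {p = p} x∈p y∈p e =
  trans (sym (enumerate-index x∈p)) (trans (cong (enumerate p) e) (enumerate-index y∈p))

nonempty⇒∣p∣>0 : {p : Subset n} → Nonempty p → 0 < ∣ p ∣
nonempty⇒∣p∣>0 (_ , x∈p) = >-nonZero⁻¹ _ {{Fin.nonZeroIndex (index x∈p)}}

∣p∣>0⇒nonempty : {p : Subset n} → 0 < ∣ p ∣ → Nonempty p
∣p∣>0⇒nonempty {p = p} ∣p∣>0 = enumerate p (fromℕ< ∣p∣>0) , enumerate-∈ p _

∣p─q∣+∣q∣≡∣p∣ : {p q : Subset n} → q ⊆ p → ∣ p ─ q ∣ + ∣ q ∣ ≡ ∣ p ∣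
∣p─q∣+∣q∣≡∣p∣ {p = []}          {[]}          _   = refl
∣p─q∣+∣q∣≡∣p∣ {p = inside  ∷ p} {outside ∷ q} q⊆p = cong suc (∣p─q∣+∣q∣≡∣p∣ (drop-∷-⊆ q⊆p))
∣p─q∣+∣q∣≡∣p∣ {p = outside ∷ p} {outside ∷ q} q⊆p = ∣p─q∣+∣q∣≡∣p∣ (drop-∷-⊆ q⊆p)
∣p─q∣+∣q∣≡∣p∣ {p = inside  ∷ p} {inside  ∷ q} q⊆p =
  trans (+-suc ∣ p ─ q ∣ ∣ q ∣) (cong suc (∣p─q∣+∣q∣≡∣p∣ (drop-∷-⊆ q⊆p)))
∣p─q∣+∣q∣≡∣p∣ {p = outside ∷ p} {inside  ∷ q} q⊆p with () ← q⊆p here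

subsetOf : {P : Fin n → Set} → (∀ x → Dec (P x)) → Subset n
subsetOf P? = tabulate (does ∘ P?)

module _ {P : Fin n → Set} (P? : ∀ x → Dec (P x)) where

  ∈subsetOf⁺ : ∀ {x} → P x → x ∈ₛ subsetOf P?
  ∈subsetOf⁺ {x} px = lookup⇒[]= x _ (trans (lookup∘tabulate (does ∘ P?) x) (dec-true (P? x) px))

  ∈subsetOf⁻ : ∀ {x} → x ∈ₛ subsetOf P? → P x
  ∈subsetOf⁻ {x} x∈ with P? x | trans (sym (lookup∘tabulate (does ∘ P?) x)) ([]=⇒lookup x∈)
  ... | yes px | _  = px
  ... | no  _  | ()

preimage? : (f : Fin m → Fin n) (y : Fin n) → Dec (∃ λ x → f x ≡ y)
preimage? f y = Fin.any? (λ x → f x Fin.≟ y)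

image : (Fin m → Fin n) → Subset n
image f = subsetOf (preimage? f)

∈image⁺ : (f : Fin m → Fin n) (x : Fin m) → f x ∈ₛ image f
∈image⁺ f x = ∈subsetOf⁺ (preimage? f) (x , refl)

∣image∣≤ : (f : Fin m → Fin n) → ∣ image f ∣ ≤ m
∣image∣≤ f = Fin.injective⇒≤ preimage-injective
  where
  preimage : ∀ i → ∃ λ x → f x ≡ enumerate (image f) i
  preimage i = ∈subsetOf⁻ (preimage? f) (enumerate-∈ (image f) i)
  preimage-injective : ∀ {i j} → proj₁ (preimage i) ≡ proj₁ (preimage j) → i ≡ j
  preimage-injective {i} {j} e = enumerate-injective (image f)
    (trans (sym (proj₂ (preimage i))) (trans (cong f e) (proj₂ (preimage j))))

covering-stream : (p : Subset n) → Nonempty p → ∣ p ∣ ≤ m →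
                  ∃ λ (w : Vec (Fin n) m) → All (_∈ₛ p) w × (∀ {x} → x ∈ₛ p → x ∈ w)
covering-stream {n = n} {m = m} p (_ , y∈p) ∣p∣≤m = tabulate cycle , tabulate⁺ (enumerate-∈ p ∘ wrap) , covers
  where
  instance
    ∣p∣≢0 : NonZero ∣ p ∣
    ∣p∣≢0 = Fin.nonZeroIndex (index y∈p)
  wrap : Fin m → Fin ∣ p ∣
  wrap i = fromℕ< (m%n<n (toℕ i) ∣ p ∣)
  cycle : Fin m → Fin n
  cycle = enumerate p ∘ wrap
  wrap-inject≤ : ∀ j → wrap (inject≤ j ∣p∣≤m) ≡ j
  wrap-inject≤ j = Fin.toℕ-injective (begin
    toℕ (wrap (inject≤ j ∣p∣≤m)) ≡⟨ Fin.toℕ-fromℕ< _ ⟩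
    toℕ (inject≤ j ∣p∣≤m) % ∣ p ∣ ≡⟨ cong (_% ∣ p ∣) (Fin.toℕ-inject≤ j _) ⟩
    toℕ j % ∣ p ∣                 ≡⟨ m<n⇒m%n≡m (Fin.toℕ<n j) ⟩
    toℕ j                         ∎)
    where open ≡-Reasoning
  covers : ∀ {x} → x ∈ₛ p → x ∈ tabulate cycle
  covers x∈p = subst (_∈ tabulate cycle)
    (trans (cong (enumerate p) (wrap-inject≤ _)) (enumerate-index x∈p))
    (∈-tabulate⁺ cycle (inject≤ (index x∈p) ∣p∣≤m))

anyVec? : {P : Vec (Fin m) t → Set} → (∀ v → Dec (P v)) → Dec (∃ P)
anyVec? {t = zero}  P? = map′ ([] ,_) (λ { ([] , p) → p }) (P? [])
anyVec? {t = suc t} P? = map′ (λ (x , v , p) → x ∷ v , p) (λ { (x ∷ v , p) → x , v , p })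
  (Fin.any? λ x → anyVec? (P? ∘ (x ∷_)))

encode : Vec (Fin m) t → Fin (m ^ t)
encode []       = zero
encode (x ∷ xs) = combine x (encode xs)

decode : Fin (m ^ t) → Vec (Fin m) t
decode {t = zero}  _ = []
decode {m} {suc t} i = let x , j = remQuot {m} (m ^ t) i in x ∷ decode j

encode-decode : (i : Fin (m ^ t)) → encode (decode {m} {t} i) ≡ i
encode-decode {t = zero}  zero = refl
encode-decode {m} {suc t} i =
  trans (cong (combine {m} (proj₁ (remQuot {m} (m ^ t) i))) (encode-decode {m} {t} _))
        (Fin.combine-remQuot {m} (m ^ t) i)

encode-injective : {u v : Vec (Fin m) t} → encode u ≡ encode v → u ≡ v
encode-injective {u = []}    {[]}    _ = refl
encode-injective {u = x ∷ u} {y ∷ v} e =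
  let x≡y , eu≡ev = Fin.combine-injective x _ y _ e in cong₂ _∷_ x≡y (encode-injective eu≡ev)

injective⇒^≤ : ∀ {k} (F : Vec (Fin m) t → Fin k) → (∀ {u v} → F u ≡ F v → u ≡ v) → m ^ t ≤ k
injective⇒^≤ {m} {t} F F-injective = Fin.injective⇒≤ {f = F ∘ decode} λ {i} {j} e →
  trans (sym (encode-decode {m} {t} i)) (trans (cong encode (F-injective e)) (encode-decode {m} {t} j))

map-injective : {A B : Set} {f : A → B} → (∀ {x y} → f x ≡ f y → x ≡ y) →
                {u v : Vec A m} → map f u ≡ map f v → u ≡ v
map-injective f-inj {[]}    {[]}    _ = refl
map-injective f-inj {x ∷ u} {y ∷ v} e =
  let x≡y , u≡v = ∷-injective e in cong₂ _∷_ (f-inj x≡y) (map-injective f-inj u≡v)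

module _ {S h : ℕ} (U : Fin S → Subset n) (∣U∣≤h : ∀ s → ∣ U s ∣ ≤ h) where

  codes : ∀ {s} {v : Vec (Fin n) m} → All (_∈ₛ U s) v → Vec (Fin h) m
  codes {s = s} = All.reduce (λ x∈U → inject≤ (index x∈U) (∣U∣≤h s))

  codes-injective : ∀ {s s'} {u v : Vec (Fin n) m} (u⊆U : All (_∈ₛ U s) u) (v⊆U : All (_∈ₛ U s') v) →
                    s ≡ s' → codes u⊆U ≡ codes v⊆U → u ≡ v
  codes-injective []            []            _    _ = refl
  codes-injective (x∈U ∷ u⊆U) (y∈U ∷ v⊆U) refl e =
    let x≡y , u≡v = ∷-injective e in
    cong₂ _∷_ (index-injective x∈U y∈U (Fin.inject≤-injective _ _ _ _ x≡y))
              (codes-injective u⊆U v⊆U refl u≡v)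

  streams-bound : (P : Subset n) (f : Vec (Fin n) t → Fin S) →
                  (∀ {v} → All (_∈ₛ P) v → All (_∈ₛ U (f v)) v) → ∣ P ∣ ^ t ≤ S * h ^ t
  streams-bound {t = t} P f covered = injective⇒^≤ code code-injective
    where
    stream⊆P : (u : Vec (Fin ∣ P ∣) t) → All (_∈ₛ P) (map (enumerate P) u)
    stream⊆P u = map⁺ (All.universal (enumerate-∈ P) u)
    code : Vec (Fin ∣ P ∣) t → Fin (S * h ^ t)
    code u = combine (f (map (enumerate P) u)) (encode (codes (covered (stream⊆P u))))
    code-injective : ∀ {u v} → code u ≡ code v → u ≡ v
    code-injective {u} {v} e =
      let same-state , same-codes = Fin.combine-injective _ _ _ _ e in
      map-injective (enumerate-injective P)
        (codes-injective (covered (stream⊆P u)) (covered (stream⊆P v)) same-state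
                         (encode-injective same-codes))

^-distribʳ-* : ∀ a b t → (a * b) ^ t ≡ a ^ t * b ^ t
^-distribʳ-* a b zero    = refl
^-distribʳ-* a b (suc t) =
  trans (cong ((a * b) *_) (^-distribʳ-* a b t)) ([m*n]*[o*p]≡[m*o]*[n*p] a b (a ^ t) (b ^ t))

c^t≤S*h^t⇒2^t≤S : ∀ {c h S} t → 0 < c → 2 * h ≤ c → c ^ t ≤ S * h ^ t → 2 ^ t ≤ S
c^t≤S*h^t⇒2^t≤S {h = zero} {S} zero    _   _ bound = ≤-trans bound (≤-reflexive (*-identityʳ S))
c^t≤S*h^t⇒2^t≤S {c} {zero} {S} (suc t) c>0 _ bound =
  contradiction (≤-trans bound (≤-reflexive (*-zeroʳ S))) (<⇒≱ (m^n>0 c {{>-nonZero c>0}} (suc t)))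
c^t≤S*h^t⇒2^t≤S {c} {h@(suc _)} {S} t _ 2h≤c bound = *-cancelʳ-≤ (2 ^ t) S (h ^ t) {{m^n≢0 h t}} (begin
  2 ^ t * h ^ t ≡⟨ ^-distribʳ-* 2 h t ⟨
  (2 * h) ^ t   ≤⟨ ^-monoˡ-≤ t 2h≤c ⟩
  c ^ t         ≤⟨ bound ⟩
  S * h ^ t     ∎)
  where open ≤-Reasoning

2*m≤n⇒m≤⌊n/2⌋ : ∀ {m n} → 2 * m ≤ n → m ≤ ⌊ n /2⌋
2*m≤n⇒m≤⌊n/2⌋ {m} {n} 2m≤n = begin
  m             ≡⟨ n≡⌊n+n/2⌋ m ⟩
  ⌊ m + m /2⌋   ≤⟨ ⌊n/2⌋-mono (subst (_≤ n) (cong (m +_) (+-identityʳ m)) 2m≤n) ⟩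
  ⌊ n /2⌋       ∎
  where open ≤-Reasoning

2*⌊n/2⌋≤n : ∀ n → 2 * ⌊ n /2⌋ ≤ n
2*⌊n/2⌋≤n n = begin
  2 * ⌊ n /2⌋         ≡⟨ cong (⌊ n /2⌋ +_) (+-identityʳ ⌊ n /2⌋) ⟩
  ⌊ n /2⌋ + ⌊ n /2⌋   ≤⟨ +-monoʳ-≤ ⌊ n /2⌋ (⌊n/2⌋≤⌈n/2⌉ n) ⟩
  ⌊ n /2⌋ + ⌈ n /2⌉   ≡⟨ ⌊n/2⌋+⌈n/2⌉≡n n ⟩
  n                   ∎
  where open ≤-Reasoning

m*n<m⇒n≡0 : ∀ {m n} → m * n < m → n ≡ 0
m*n<m⇒n≡0 {m} {zero}  _     = refl
m*n<m⇒n≡0 {m} {suc n} mn<m = contradiction (m≤m*n m (suc n)) (<⇒≱ mn<m)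

2*[m∸n]<m⇒m<2*n : ∀ m n → 2 * (m ∸ n) < m → m < 2 * n
2*[m∸n]<m⇒m<2*n m n 2[m∸n]<m = +-cancelʳ-< m m (2 * n) (begin-strict
  m + m                   ≡⟨ cong (m +_) (+-identityʳ m) ⟨
  2 * m                   ≤⟨ *-monoʳ-≤ 2 (m≤n+m∸n m n) ⟩
  2 * (n + (m ∸ n))       ≡⟨ *-distribˡ-+ 2 n (m ∸ n) ⟩
  2 * n + 2 * (m ∸ n)     <⟨ +-monoʳ-< (2 * n) 2[m∸n]<m ⟩
  2 * n + m               ∎)
  where open ≤-Reasoning

s*s≤m*[1+m]⇒s≤m : ∀ {s m} → s * s ≤ m * suc m → s ≤ m
s*s≤m*[1+m]⇒s≤m {s} {m} s*s≤ = ≮⇒≥ λ m<s → <-irrefl refl (begin-strict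
  m * suc m         <⟨ m<n+m (m * suc m) z<s ⟩
  suc m * suc m     ≤⟨ *-mono-≤ m<s m<s ⟩
  s * s             ≤⟨ s*s≤ ⟩
  m * suc m         ∎)
  where open ≤-Reasoning

m≤o⇒n<4*[1+o]⇒m+n≤8*o : ∀ {m n o} → m ≤ o → n < 4 * suc o → 0 < o → m + n ≤ 8 * o
m≤o⇒n<4*[1+o]⇒m+n≤8*o {m} {n} {suc o} m≤o n<4[1+o] _ = s≤s⁻¹ (begin
  suc (m + n)                   ≡⟨ +-suc m n ⟨
  m + suc n                     ≤⟨ +-mono-≤ m≤o n<4[1+o] ⟩
  suc o + 4 * suc (suc o)       ≡⟨ lhs o ⟩
  9 + 5 * o                     ≤⟨ +-monoʳ-≤ 9 (*-monoˡ-≤ o (m≤m+n 5 3)) ⟩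
  9 + 8 * o                     ≡⟨ rhs o ⟩
  suc (8 * suc o)               ∎)
  where
  open ≤-Reasoning
  lhs : ∀ b → suc b + 4 * suc (suc b) ≡ 9 + 5 * b
  lhs = solve-∀
  rhs : ∀ b → 9 + 8 * b ≡ suc (8 * suc b)
  rhs = solve-∀

n≤2*⌈n/2⌉ : ∀ n → n ≤ 2 * ⌈ n /2⌉
n≤2*⌈n/2⌉ n = begin
  n                   ≡⟨ ⌊n/2⌋+⌈n/2⌉≡n n ⟨
  ⌊ n /2⌋ + ⌈ n /2⌉   ≤⟨ +-monoˡ-≤ ⌈ n /2⌉ (⌊n/2⌋≤⌈n/2⌉ n) ⟩
  ⌈ n /2⌉ + ⌈ n /2⌉   ≡⟨ cong (⌈ n /2⌉ +_) (+-identityʳ ⌈ n /2⌉) ⟨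
  2 * ⌈ n /2⌉         ∎
  where open ≤-Reasoning

n≤2^⌈log₂n⌉ : ∀ n → n ≤ 2 ^ ⌈log₂ n ⌉
n≤2^⌈log₂n⌉ n = go n (<-wellFounded n)
  where
  open ≤-Reasoning
  go : ∀ m (rec : Acc _<_ m) → m ≤ 2 ^ ⌈log2⌉ m rec
  go zero          _        = z≤n
  go (suc zero)    _        = ≤-refl
  go (suc (suc m)) (acc rs) = begin
    2 + m                                      ≤⟨ +-monoʳ-≤ 2 (n≤2*⌈n/2⌉ m) ⟩
    2 + 2 * ⌈ m /2⌉                            ≡⟨ *-suc 2 ⌈ m /2⌉ ⟨
    2 * suc ⌈ m /2⌉                            ≤⟨ *-monoʳ-≤ 2 (go _ (rs (⌈n/2⌉<n m))) ⟩
    2 * 2 ^ ⌈log2⌉ (suc ⌈ m /2⌉) (rs (⌈n/2⌉<n m)) ∎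

n<2^[1+⌊log₂n⌋] : ∀ n → n < 2 ^ suc ⌊log₂ n ⌋
n<2^[1+⌊log₂n⌋] n = ≰⇒> λ 2^[1+L]≤n → 1+n≰n (begin
  suc ⌊log₂ n ⌋                ≡⟨ ⌊log₂[2^n]⌋≡n (suc ⌊log₂ n ⌋) ⟨
  ⌊log₂ 2 ^ suc ⌊log₂ n ⌋ ⌋    ≤⟨ ⌊log₂⌋-mono-≤ 2^[1+L]≤n ⟩
  ⌊log₂ n ⌋                    ∎)
  where open ≤-Reasoning

module _ {n : ℕ} (A : StreamAlg n) where

  SolvesFrom : Fin (states A) → ℕ → Subset n → Subset n → Set
  SolvesFrom q k P Q = (w : Vec (Fin n) k) → All (_∈ₛ P) w →
                       out A (run A q w) ∈ₛ Q × out A (run A q w) ∉ w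

  run-++ : ∀ {m k} q (v : Vec (Fin n) m) (w : Vec (Fin n) k) → run A q (v ++ w) ≡ run A (run A q v) w
  run-++ q []      w = refl
  run-++ q (a ∷ v) w = run-++ (δ A q a) v w

  solvesFrom-antitone : ∀ {q k P P′ Q} → P′ ⊆ P → SolvesFrom q k P Q → SolvesFrom q k P′ Q
  solvesFrom-antitone P′⊆P sol w w⊆P′ = sol w (All.map P′⊆P w⊆P′)

  solvesFrom-nonempty : ∀ {q k P Q} → Nonempty P → SolvesFrom q k P Q → Nonempty Q
  solvesFrom-nonempty (x , x∈P) sol = _ , proj₁ (sol (tabulate λ _ → x) (tabulate⁺ λ _ → x∈P))

  solvesFrom⇒k<∣P∣ : ∀ {q k P} → Nonempty P → SolvesFrom q k P P → k < ∣ P ∣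
  solvesFrom⇒k<∣P∣ {P = P} ne sol = ≰⇒> λ ∣P∣≤k →
    let w , w⊆P , covers = covering-stream P ne ∣P∣≤k
        y∈P , y∉w = sol w w⊆P
    in y∉w (covers y∈P)

  module Seen (q : Fin (states A)) (t : ℕ) (P : Subset n) where

    Reaches : Fin (states A) → Fin n → Set
    Reaches s x = ∃ λ (v : Vec (Fin n) t) → All (_∈ₛ P) v × run A q v ≡ s × x ∈ v

    reaches? : ∀ s x → Dec (Reaches s x)
    reaches? s x = anyVec? λ v → All.all? (_∈ₛ? P) v ×-dec run A q v Fin.≟ s ×-dec x ∈? v
      where open import Data.Vec.Membership.DecPropositional (Fin._≟_ {n}) using (_∈?_)

    seen : Fin (states A) → Subset n
    seen s = subsetOf (reaches? s)

    ∈seen⁺ : ∀ {v x} → All (_∈ₛ P) v → x ∈ v → x ∈ₛ seen (run A q v)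
    ∈seen⁺ v⊆P x∈v = ∈subsetOf⁺ (reaches? _) (_ , v⊆P , refl , x∈v)

    ∈seen⁻ : ∀ {s x} → x ∈ₛ seen s → Reaches s x
    ∈seen⁻ = ∈subsetOf⁻ (reaches? _)

    seen⊆P : ∀ {s} → seen s ⊆ P
    seen⊆P x∈seen = let _ , v⊆P , _ , x∈v = ∈seen⁻ x∈seen in All.lookup v⊆P x∈v

  module Halving (q : Fin (states A)) (t k : ℕ) (P : Subset n) (sol : SolvesFrom q (t + k) P P) where
    open Seen q t P

    unseen-answers : ∀ {v₀} → All (_∈ₛ P) v₀ → SolvesFrom (run A q v₀) k P (P ─ seen (run A q v₀))
    unseen-answers {v₀} v₀⊆P w w⊆P = x∈p∧x∉q⇒x∈p─q y∈P y∉seen , y∉v₀++w ∘ ∈-++⁺ʳ v₀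
      where
      answer-after : ∀ {v} → All (_∈ₛ P) v →
                     out A (run A (run A q v) w) ∈ₛ P × out A (run A (run A q v) w) ∉ v ++ w
      answer-after {v} v⊆P =
        subst (λ s → out A s ∈ₛ P × out A s ∉ v ++ w) (run-++ q v w) (sol (v ++ w) (++⁺ v⊆P w⊆P))
      y : Fin n
      y = out A (run A (run A q v₀) w)
      y∈P : y ∈ₛ P
      y∈P = proj₁ (answer-after v₀⊆P)
      y∉v₀++w : y ∉ v₀ ++ w
      y∉v₀++w = proj₂ (answer-after v₀⊆P)
      y∉seen : y ∉ₛ seen (run A q v₀)
      y∉seen y∈seen =
        let v₁ , v₁⊆P , v₁↦s , y∈v₁ = ∈seen⁻ y∈seen in
        proj₂ (answer-after v₁⊆P) (subst (λ s → out A (run A s w) ∈ v₁ ++ w) (sym v₁↦s) (∈-++⁺ˡ y∈v₁))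

    halving : Nonempty P →
              2 ^ t ≤ states A ⊎ ∃₂ λ s P′ → Nonempty P′ × 2 * ∣ P′ ∣ ≤ ∣ P ∣ × SolvesFrom s k P′ P′
    halving ne with Fin.any? (λ s → ∣ P ∣ ≤? 2 * ∣ seen s ∣)
    ... | yes (s , ∣P∣≤2∣U∣) = inj₂ (s , P ─ U , solvesFrom-nonempty ne answers , halved ,
                                    solvesFrom-antitone (p─q⊆p P U) answers)
      where
      U : Subset n
      U = seen s
      U-nonempty : Nonempty U
      U-nonempty = ∣p∣>0⇒nonempty (n≢0⇒n>0 λ ∣U∣≡0 →
        <⇒≱ (nonempty⇒∣p∣>0 ne) (subst (λ u → ∣ P ∣ ≤ 2 * u) ∣U∣≡0 ∣P∣≤2∣U∣))
      answers : SolvesFrom s k P (P ─ U)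
      answers = let _ , v₀⊆P , v₀↦s , _ = ∈seen⁻ (proj₂ U-nonempty) in
        subst (λ s → SolvesFrom s k P (P ─ seen s)) v₀↦s (unseen-answers v₀⊆P)
      halved : 2 * ∣ P ─ U ∣ ≤ ∣ P ∣
      halved = +-cancelʳ-≤ (2 * ∣ U ∣) (2 * ∣ P ─ U ∣) ∣ P ∣ (begin
        2 * ∣ P ─ U ∣ + 2 * ∣ U ∣   ≡⟨ *-distribˡ-+ 2 ∣ P ─ U ∣ ∣ U ∣ ⟨
        2 * (∣ P ─ U ∣ + ∣ U ∣)     ≡⟨ cong (2 *_) (∣p─q∣+∣q∣≡∣p∣ seen⊆P) ⟩
        2 * ∣ P ∣                   ≡⟨ cong (∣ P ∣ +_) (+-identityʳ ∣ P ∣) ⟩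
        ∣ P ∣ + ∣ P ∣               ≤⟨ +-monoʳ-≤ ∣ P ∣ ∣P∣≤2∣U∣ ⟩
        ∣ P ∣ + 2 * ∣ U ∣           ∎)
        where open ≤-Reasoning
    ... | no ¬large = inj₁ (c^t≤S*h^t⇒2^t≤S t (nonempty⇒∣p∣>0 ne) (2*⌊n/2⌋≤n ∣ P ∣)
                             (streams-bound seen small P (run A q) λ v⊆P →
                                lookup⁻ λ i → ∈seen⁺ v⊆P (∈-lookup i _)))
      where
      small : ∀ s → ∣ seen s ∣ ≤ ⌊ ∣ P ∣ /2⌋
      small s = 2*m≤n⇒m≤⌊n/2⌋ (<⇒≤ (≰⇒> (¬large ∘ (s ,_))))

  solvesFrom⇒2^t≤S : ∀ {t k} i {q P} → Nonempty P → ∣ P ∣ ≤ 2 ^ i * k →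
                     SolvesFrom q (i * t + k) P P → 2 ^ t ≤ states A
  solvesFrom⇒2^t≤S {t} {k} zero ne ∣P∣≤k sol =
    contradiction (≤-trans ∣P∣≤k (≤-reflexive (*-identityˡ k))) (<⇒≱ (solvesFrom⇒k<∣P∣ ne sol))
  solvesFrom⇒2^t≤S {t} {k} (suc i) {q} {P} ne ∣P∣≤ sol
    with Halving.halving q t (i * t + k) P (subst (λ ℓ → SolvesFrom q ℓ P P) (+-assoc t (i * t) k) sol) ne
  ... | inj₁ 2^t≤S = 2^t≤S
  ... | inj₂ (_ , _ , ne′ , halved , sol′) =
    solvesFrom⇒2^t≤S i ne′ (*-cancelˡ-≤ 2 (≤-trans halved (≤-trans ∣P∣≤ (≤-reflexive (*-assoc 2 (2 ^ i) k)))))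
                     sol′

  solvesFrom⇒2^i*[r∸i*[1+space]]<∣P∣ : ∀ {q r P} → Nonempty P → SolvesFrom q r P P →
                                       ∀ i → 2 ^ i * (r ∸ i * suc (space A)) < ∣ P ∣
  solvesFrom⇒2^i*[r∸i*[1+space]]<∣P∣ {q} {r} {P} ne sol i with i * suc (space A) ≤? r
  ... | yes ib≤r = ≰⇒> λ ∣P∣≤ → <⇒≱ (^-monoʳ-< 2 (s<s z<s) (n<1+n (space A))) (≤-trans
          (solvesFrom⇒2^t≤S i ne ∣P∣≤ (subst (λ ℓ → SolvesFrom q ℓ P P) (sym (m+[n∸m]≡n ib≤r)) sol))
          (n≤2^⌈log₂n⌉ (states A)))
  ... | no ib≰r = subst (_< ∣ P ∣)
          (sym (trans (cong (2 ^ i *_) (m≤n⇒m∸n≡0 (<⇒≤ (≰⇒> ib≰r)))) (*-zeroʳ (2 ^ i))))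
          (nonempty⇒∣p∣>0 ne)

module SpaceBound {n r : ℕ} .{{_ : NonZero r}} (A : StreamAlg n) (solves : SolvesMIF n r A) where

  b : ℕ
  b = space A

  L : ℕ
  L = ⌊log₂ (n / r) ⌋

  outputs : Subset n
  outputs = image (out A)

  outputs-nonempty : Nonempty outputs
  outputs-nonempty = _ , ∈image⁺ (out A) (init A)

  solvesFrom-outputs : SolvesFrom A (init A) r outputs outputs
  solvesFrom-outputs w _ = ∈image⁺ (out A) _ , solves w

  r≤b*[1+b] : r ≤ b * suc b
  r≤b*[1+b] = m∸n≡0⇒m≤n (m*n<m⇒n≡0 (<-≤-trans
    (solvesFrom⇒2^i*[r∸i*[1+space]]<∣P∣ A outputs-nonempty solvesFrom-outputs b)
    (≤-trans (∣image∣≤ (out A)) (n≤2^⌈log₂n⌉ (states A)))))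

  n<2^[1+L]*r : n < 2 ^ suc L * r
  n<2^[1+L]*r = begin-strict
    n                      ≡⟨ m≡m%n+[m/n]*n n r ⟩
    n % r + (n / r) * r    <⟨ +-monoˡ-< ((n / r) * r) (m%n<n n r) ⟩
    suc (n / r) * r        ≤⟨ *-monoˡ-≤ r (n<2^[1+⌊log₂n⌋] (n / r)) ⟩
    2 ^ suc L * r          ∎
    where open ≤-Reasoning

  r<2*[2+L]*[1+b] : r < 2 * ((2 + L) * suc b)
  r<2*[2+L]*[1+b] = 2*[m∸n]<m⇒m<2*n r ((2 + L) * suc b) (*-cancelˡ-< (2 ^ suc L) (2 * k) r (begin-strict
    2 ^ suc L * (2 * k)    ≡⟨ *-assoc (2 ^ suc L) 2 k ⟨
    2 ^ suc L * 2 * k      ≡⟨ cong (_* k) (*-comm (2 ^ suc L) 2) ⟩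
    2 ^ (2 + L) * k        <⟨ solvesFrom⇒2^i*[r∸i*[1+space]]<∣P∣ A outputs-nonempty solvesFrom-outputs (2 + L) ⟩
    ∣ outputs ∣            ≤⟨ ∣p∣≤n outputs ⟩
    n                      <⟨ n<2^[1+L]*r ⟩
    2 ^ suc L * r          ∎))
    where
    open ≤-Reasoning
    k : ℕ
    k = r ∸ (2 + L) * suc b

  r/[1+L]<4*[1+b] : r / (1 + L) < 4 * suc b
  r/[1+L]<4*[1+b] = m<n*o⇒m/o<n (begin-strict
    r                                           <⟨ r<2*[2+L]*[1+b] ⟩
    2 * ((2 + L) * suc b)                       ≤⟨ m≤m+n _ (2 * L * suc b) ⟩
    2 * ((2 + L) * suc b) + 2 * L * suc b       ≡⟨ rearrange L b ⟩
    4 * suc b * (1 + L)                         ∎)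
    where
    open ≤-Reasoning
    rearrange : ∀ L b → 2 * ((2 + L) * suc b) + 2 * L * suc b ≡ 4 * suc b * (1 + L)
    rearrange = solve-∀

  b>0 : 0 < b
  b>0 with b | r≤b*[1+b]
  ... | zero  | r≤0 = contradiction r≤0 (<⇒≱ (>-nonZero⁻¹ r))
  ... | suc _ | _   = z<s

  space-bound : ∀ s → s * s ≤ r → s + r / (1 + L) ≤ 8 * b
  space-bound s s*s≤r =
    m≤o⇒n<4*[1+o]⇒m+n≤8*o (s*s≤m*[1+m]⇒s≤m (≤-trans s*s≤r r≤b*[1+b])) r/[1+L]<4*[1+b] b>0

theorem7 : ∃ λ (C : ℕ) → ∀ (n r : ℕ) .{{_ : NonZero r}} → r < n →
             ∀ (A : StreamAlg n) → SolvesMIF n r A →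
             ∀ (s : ℕ) → s * s ≤ r →
             s + r / (1 + ⌊log₂ (n / r) ⌋) ≤ C * space A
theorem7 = 8 , λ n r _ A solves → SpaceBound.space-bound A solves
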